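{- Let $\mathbf A=\langle A,\to,\wedge,1\rangle$ be a Girard semilattice satisfying, for all $x,y\in A$, $x\le ((x\to y)\wedge 1)\to y$. Then for all $a,b,c\in A$: (1) $a\le b$ if and only if $a\to b\ge 1$; (2) $a\le (a\to b)\to b$; (3) $a\le b$ implies $b\to c\le a\to c$ and $c\to a\le c\to b$.
   Context: A (pointed) Girard semilattice is an algebra $\langle A,\to,\wedge,1\rangle$ such that $\langle A,\wedge,1\rangle$ is a meet-semilattice with a constant $1$ (with $\le$ the semilattice order) and for all $a,b,c\in A$: (L1) $1\to a=a$; (L2) $a\to a\ge 1$; (L3) $(a\to b)\wedge(a\to c)=a\to(b\wedge c)$; (L4) $a\to b\le (c\to a)\to(c\to b)$; (L5) $a\to(b\to c)\le b\to(a\to c)$; (L6) if $a\to b\ge 1$ and $b\to a\ge 1$ then $a=b$. -}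

module Defs where

open import Level using (Level; suc)
open import Relation.Binary.PropositionalEquality using (_≡_)

record GirardSemilattice (a : Level) : Set (suc a) where
  infixr 5 _⇒_
  infixr 6 _∧_
  infix 4 _≤_
  field
    Carrier : Set a
    _⇒_     : Carrier → Carrier → Carrier
    _∧_     : Carrier → Carrier → Carrier
    𝟙       : Carrier
    ∧-assoc : ∀ x y z → (x ∧ y) ∧ z ≡ x ∧ (y ∧ z)
    ∧-comm  : ∀ x y → x ∧ y ≡ y ∧ x
    ∧-idem  : ∀ x → x ∧ x ≡ x

  _≤_ : Carrier → Carrier → Set a
  x ≤ y = x ≡ x ∧ y

  field
    L1 : ∀ x → 𝟙 ⇒ x ≡ x
    L2 : ∀ x → 𝟙 ≤ x ⇒ x
    L3 : ∀ x y z → (x ⇒ y) ∧ (x ⇒ z) ≡ x ⇒ (y ∧ z)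
    L4 : ∀ x y z → x ⇒ y ≤ (z ⇒ x) ⇒ (z ⇒ y)
    L5 : ∀ x y z → x ⇒ (y ⇒ z) ≤ y ⇒ (x ⇒ z)
    L6 : ∀ x y → 𝟙 ≤ x ⇒ y → 𝟙 ≤ y ⇒ x → x ≡ y

{-# OPTIONS --safe #-}
module Submission where

-- Isotonicity of x ⇒ _ is (L3), and it turns a ≤ b into 1 ≤ a ⇒ a ≤ a ⇒ b.  The
-- hypothesis gives the converse: if 1 ≤ x ⇒ y then (x ⇒ y) ∧ 1 = 1, so it says
-- x ≤ 1 ⇒ y = y.  With this residuation, (2) is the exchange law (L5) applied to
-- 1 ≤ (x ⇒ y) ⇒ (x ⇒ y), and antitonicity is the prefixing law (L4) exchanged into
-- suffixing and then detached by modus ponens.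

open import Defs
open import Level using (Level)
open import Data.Product using (_×_; _,_)
open import Function.Bundles using (_⇔_; mk⇔)
open import Relation.Binary.PropositionalEquality

module GirardSemilatticeProperties {ℓ : Level} (G : GirardSemilattice ℓ) where
  open GirardSemilattice G
  open ≡-Reasoning

  ≤-trans : ∀ {x y z} → x ≤ y → y ≤ z → x ≤ z
  ≤-trans {x} {y} {z} x≤y y≤z = begin
    x           ≡⟨ x≤y ⟩
    x ∧ y       ≡⟨ cong (x ∧_) y≤z ⟩
    x ∧ (y ∧ z) ≡⟨ sym (∧-assoc x y z) ⟩
    (x ∧ y) ∧ z ≡⟨ cong (_∧ z) (sym x≤y) ⟩
    x ∧ z       ∎

  ⇒-monoʳ-≤ : ∀ x {y z} → y ≤ z → x ⇒ y ≤ x ⇒ z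
  ⇒-monoʳ-≤ x {y} {z} y≤z = trans (cong (x ⇒_) y≤z) (sym (L3 x y z))

  ≤⇒𝟙≤⇒ : ∀ {x y} → x ≤ y → 𝟙 ≤ x ⇒ y
  ≤⇒𝟙≤⇒ {x} x≤y = ≤-trans (L2 x) (⇒-monoʳ-≤ x x≤y)

  module Residuated (residual : ∀ x y → x ≤ ((x ⇒ y) ∧ 𝟙) ⇒ y) where

    𝟙≤⇒⇒≤ : ∀ {x y} → 𝟙 ≤ x ⇒ y → x ≤ y
    𝟙≤⇒⇒≤ {x} {y} 𝟙≤x⇒y = subst (x ≤_) [x⇒y∧𝟙]⇒y≡y (residual x y)
      where
      [x⇒y∧𝟙]⇒y≡y : ((x ⇒ y) ∧ 𝟙) ⇒ y ≡ y
      [x⇒y∧𝟙]⇒y≡y = begin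
        ((x ⇒ y) ∧ 𝟙) ⇒ y ≡⟨ cong (_⇒ y) (∧-comm (x ⇒ y) 𝟙) ⟩
        (𝟙 ∧ (x ⇒ y)) ⇒ y ≡⟨ cong (_⇒ y) (sym 𝟙≤x⇒y) ⟩
        𝟙 ⇒ y             ≡⟨ L1 y ⟩
        y                 ∎

    ≤⇔𝟙≤⇒ : ∀ {x y} → (x ≤ y) ⇔ (𝟙 ≤ x ⇒ y)
    ≤⇔𝟙≤⇒ = mk⇔ ≤⇒𝟙≤⇒ 𝟙≤⇒⇒≤

    x≤[x⇒y]⇒y : ∀ x y → x ≤ (x ⇒ y) ⇒ y
    x≤[x⇒y]⇒y x y = 𝟙≤⇒⇒≤ (≤-trans (L2 (x ⇒ y)) (L5 (x ⇒ y) x y))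

    𝟙≤-modusPonens : ∀ {x y} → 𝟙 ≤ x → 𝟙 ≤ x ⇒ y → 𝟙 ≤ y
    𝟙≤-modusPonens 𝟙≤x 𝟙≤x⇒y = ≤-trans 𝟙≤x (𝟙≤⇒⇒≤ 𝟙≤x⇒y)

    suffixing : ∀ x y z → 𝟙 ≤ (x ⇒ y) ⇒ ((y ⇒ z) ⇒ (x ⇒ z))
    suffixing x y z = ≤-trans (≤⇒𝟙≤⇒ (L4 y z x)) (L5 (y ⇒ z) (x ⇒ y) (x ⇒ z))

    ⇒-antiˡ-≤ : ∀ z {x y} → x ≤ y → y ⇒ z ≤ x ⇒ z
    ⇒-antiˡ-≤ z {x} {y} x≤y =
      𝟙≤⇒⇒≤ (𝟙≤-modusPonens (≤⇒𝟙≤⇒ x≤y) (suffixing x y z))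

mainTheorem3 : ∀ {ℓ : Level} (G : GirardSemilattice ℓ) → let open GirardSemilattice G in (∀ x y → x ≤ ((x ⇒ y) ∧ 𝟙) ⇒ y) → ∀ a b c → ((a ≤ b) ⇔ (𝟙 ≤ a ⇒ b)) × (a ≤ (a ⇒ b) ⇒ b) × (a ≤ b → (b ⇒ c ≤ a ⇒ c) × (c ⇒ a ≤ c ⇒ b))
mainTheorem3 G residual a b c =
  ≤⇔𝟙≤⇒ , x≤[x⇒y]⇒y a b , λ a≤b → ⇒-antiˡ-≤ c a≤b , ⇒-monoʳ-≤ c a≤b
  where
  open GirardSemilatticeProperties G
  open Residuated residual
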